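{- Let $\mathcal P_d=(P,R,f)$ be a DPS instance whose graph $(P,R)$ is a star. Then its poly density is $d=\sum_{e\in R}\frac{1}{f_e}$.
   Context: A Decision Polyamorous Scheduling (DPS) instance $(P,R,f)$ consists of a finite simple undirected graph $(P,R)$ with integer frequencies $f:R\to\mathbb N$, $f_e=f(e)$. Let $\mathcal M$ be the set of inclusion-maximal matchings of $(P,R)$ and $\mathcal Z$ the set of weightings $z:R\to[0,1]$ with $\sum_{e\in R}z_e=1$. The poly density is $d=\max_{z\in\mathcal Z}\left(\max_{M\in\mathcal M}\sum_{e\in M} z_e f_e\right)^{ -1}$.
   Formalization: The weightings $z:R\to[0,1]$ over which the poly density is maximised take rational values only, instead of real values in [0,1]. -}

module Defs where

open import Data.Nat using (ℕ; zero; suc)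
open import Data.Fin using (Fin; zero; suc)
open import Data.Bool using (Bool; true; false; if_then_else_)
open import Data.Product using (Σ; _×_; _,_; proj₁; proj₂; ∃; ∃-syntax)
open import Data.Sum using (_⊎_)
open import Data.Integer using (+_)
open import Data.Rational using (ℚ; 0ℚ; 1ℚ; _/_; _+_; _*_; _≤_)
open import Relation.Binary.PropositionalEquality using (_≡_; _≢_)
open import Relation.Nullary using (¬_)

record Graph : Set where
  field
    n     : ℕ
    m     : ℕ
    edge  : Fin m → Fin n × Fin n
    loopless : ∀ e → proj₁ (edge e) ≢ proj₂ (edge e)
    noMulti  : ∀ e e' →
      ((proj₁ (edge e) ≡ proj₁ (edge e') × proj₂ (edge e) ≡ proj₂ (edge e'))
       ⊎ (proj₁ (edge e) ≡ proj₂ (edge e') × proj₂ (edge e) ≡ proj₁ (edge e')))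
      → e ≡ e'
open Graph public

Incident : (G : Graph) → Fin (n G) → Fin (m G) → Set
Incident G v e = (proj₁ (edge G e) ≡ v) ⊎ (proj₂ (edge G e) ≡ v)

-- The graph is a star: there is a centre c incident to every edge, every
-- other vertex lies on some edge, and there is at least one edge.
IsStar : Graph → Set
IsStar G = Σ (Fin (n G)) λ c →
  (∀ e → Incident G c e) ×
  (∀ v → v ≢ c → ∃[ e ] Incident G v e) ×
  Fin (m G)

EdgeSet : Graph → Set
EdgeSet G = Fin (m G) → Bool

IsMatching : (G : Graph) → EdgeSet G → Set
IsMatching G M = ∀ e e' → e ≢ e' → M e ≡ true → M e' ≡ true →
  ¬ (∃[ v ] (Incident G v e × Incident G v e'))

_⊆ₑ_ : {G : Graph} → EdgeSet G → EdgeSet G → Set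
M ⊆ₑ M' = ∀ e → M e ≡ true → M' e ≡ true

IsMaximalMatching : (G : Graph) → EdgeSet G → Set
IsMaximalMatching G M = IsMatching G M ×
  (∀ M' → IsMatching G M' → _⊆ₑ_ {G} M M' → _⊆ₑ_ {G} M' M)

sumℚ : ∀ {k} → (Fin k → ℚ) → ℚ
sumℚ {zero}  g = 0ℚ
sumℚ {suc k} g = g zero + sumℚ (λ i → g (suc i))

ℕ→ℚ : ℕ → ℚ
ℕ→ℚ k = + k / 1

-- reciprocal 1/k of a natural number (0 for k = 0; only used for k ≥ 1)
recipℕ : ℕ → ℚ
recipℕ zero    = 0ℚ
recipℕ (suc k) = + 1 / suc k

IsWeighting : (G : Graph) → (Fin (m G) → ℚ) → Set
IsWeighting G z = (∀ e → (0ℚ ≤ z e) × (z e ≤ 1ℚ)) × (sumℚ z ≡ 1ℚ)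

matchValue : (G : Graph) → (Fin (m G) → ℕ) → (Fin (m G) → ℚ) → EdgeSet G → ℚ
matchValue G f z M = sumℚ (λ e → if M e then z e * ℕ→ℚ (f e) else 0ℚ)

IsMaxMatchValue : (G : Graph) → (Fin (m G) → ℕ) → (Fin (m G) → ℚ) → ℚ → Set
IsMaxMatchValue G f z V =
  (∃[ M ] (IsMaximalMatching G M × matchValue G f z M ≡ V)) ×
  (∀ M → IsMaximalMatching G M → matchValue G f z M ≤ V)

-- d is the poly density: d = max over weightings z of (max_M Σ z_e f_e)^{-1}.
-- "V⁻¹ = d" is expressed as V * d ≡ 1 and "V⁻¹ ≤ d" as 1 ≤ V * d (V > 0).
IsPolyDensity : (G : Graph) → (Fin (m G) → ℕ) → ℚ → Set
IsPolyDensity G f d =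
  (∃[ z ] ∃[ V ] (IsWeighting G z × IsMaxMatchValue G f z V × V * d ≡ 1ℚ)) ×
  (∀ z V → IsWeighting G z → IsMaxMatchValue G f z V → 1ℚ ≤ V * d)

{-# OPTIONS --safe #-}
-- In a star any two edges share the centre, so the maximal matchings are exactly
-- the single edges and max_M Σ_{e∈M} z_e f_e = max_e z_e f_e =: V. Hence
-- 1 = Σ_e z_e = Σ_e (z_e f_e)/f_e ≤ V Σ_e 1/f_e for every weighting z, and
-- equality holds for z_e ∝ 1/f_e, which makes every product z_e f_e equal.
module Submission where

open import Defs
open import Data.Nat using (ℕ; _≤_)
open import Data.Fin using (Fin)

open import Data.Bool using (Bool; true; false; if_then_else_)
open import Data.Empty using (⊥-elim)
open import Data.Fin using (zero; suc)
open import Data.Fin.Properties using (_≟_; suc-injective; 0≢1+n)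
import Data.Integer as ℤ
open import Data.Nat.Coprimality using (1-coprimeTo)
import Data.Nat.Coprimality as Coprime
open import Data.Product using (_×_; _,_; ∃-syntax)
open import Data.Rational
  using (ℚ; 0ℚ; 1ℚ; mkℚ; _+_; _*_; _<_; 1/_; NonZero; Positive; NonNegative; positive; nonNegative)
  renaming (_≤_ to _≤ℚ_)
open import Data.Rational.Properties hiding (_≟_)
open import Function using (_∘_)
open import Relation.Nullary using (yes; no)
open import Relation.Nullary.Decidable using (does; dec-true; decidable-stable)
open import Relation.Binary.PropositionalEquality
  using (_≡_; refl; sym; trans; cong; cong₂; subst; module ≡-Reasoning)

-- normalize-coprime turns both fractions into mkℚ literals, on which 1/_ computes.
ℕ→ℚ-*-recipℕ : ∀ {n} → 1 ≤ n → ℕ→ℚ n * recipℕ n ≡ 1ℚ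
ℕ→ℚ-*-recipℕ {ℕ.suc k} _
  rewrite normalize-coprime {ℕ.suc k} {0} (Coprime.sym (1-coprimeTo (ℕ.suc k)))
        | normalize-coprime {1} {k} (1-coprimeTo (ℕ.suc k))
  = *-inverseʳ (mkℚ (ℤ.+ ℕ.suc k) 0 (Coprime.sym (1-coprimeTo (ℕ.suc k))))

recipℕ-nonNeg : ∀ n → 0ℚ ≤ℚ recipℕ n
recipℕ-nonNeg ℕ.zero    = ≤-refl
recipℕ-nonNeg (ℕ.suc k) =
  subst (0ℚ ≤ℚ_) (sym (normalize-coprime (1-coprimeTo (ℕ.suc k)))) (nonNegative⁻¹ _)

recipℕ-pos : ∀ {n} → 1 ≤ n → 0ℚ < recipℕ n
recipℕ-pos {ℕ.suc k} _ =
  subst (0ℚ <_) (sym (normalize-coprime (1-coprimeTo (ℕ.suc k)))) (positive⁻¹ _)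

sumℚ-mono-≤ : ∀ {k} {g h : Fin k → ℚ} → (∀ i → g i ≤ℚ h i) → sumℚ g ≤ℚ sumℚ h
sumℚ-mono-≤ {ℕ.zero}  _   = ≤-refl
sumℚ-mono-≤ {ℕ.suc _} g≤h = +-mono-≤ (g≤h zero) (sumℚ-mono-≤ (g≤h ∘ suc))

sumℚ-zero : ∀ {k} {g : Fin k → ℚ} → (∀ i → g i ≡ 0ℚ) → sumℚ g ≡ 0ℚ
sumℚ-zero {ℕ.zero}  _   = refl
sumℚ-zero {ℕ.suc _} g≗0 =
  trans (cong₂ _+_ (g≗0 zero) (sumℚ-zero (g≗0 ∘ suc))) (+-identityˡ 0ℚ)

*-distribˡ-sumℚ : ∀ {k} c (g : Fin k → ℚ) → c * sumℚ g ≡ sumℚ (λ i → c * g i)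
*-distribˡ-sumℚ {ℕ.zero}  c g = *-zeroʳ c
*-distribˡ-sumℚ {ℕ.suc _} c g =
  trans (*-distribˡ-+ c (g zero) _) (cong ((c * g zero) +_) (*-distribˡ-sumℚ c (g ∘ suc)))

select : ∀ {k} → (Fin k → Bool) → (Fin k → ℚ) → Fin k → ℚ
select M g i = if M i then g i else 0ℚ

-- does rather than ⌊_⌋, so that singleton (suc i) (suc j) reduces to singleton i j.
singleton : ∀ {k} → Fin k → Fin k → Bool
singleton i j = does (j ≟ i)

AtMostOne : ∀ {k} → (Fin k → Bool) → Set
AtMostOne M = ∀ {i j} → M i ≡ true → M j ≡ true → i ≡ j

singleton-member : ∀ {k} {i j : Fin k} → singleton i j ≡ true → j ≡ i
singleton-member {i = i} {j} j∈ with j ≟ i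
singleton-member _  | yes j≡i = j≡i
singleton-member () | no _

singleton-atMostOne : ∀ {k} (i : Fin k) → AtMostOne (singleton i)
singleton-atMostOne i j∈ j′∈ = trans (singleton-member j∈) (sym (singleton-member j′∈))

sumℚ-select-singleton : ∀ {k} (i : Fin k) (g : Fin k → ℚ) →
  sumℚ (select (singleton i) g) ≡ g i
sumℚ-select-singleton {ℕ.suc k} zero g =
  trans (cong (g zero +_) (sumℚ-zero {k} (λ _ → refl))) (+-identityʳ (g zero))
sumℚ-select-singleton {ℕ.suc _} (suc i) g =
  trans (+-identityˡ _) (sumℚ-select-singleton i (g ∘ suc))

sumℚ-select-≤ : ∀ {k} {M : Fin k → Bool} {B} (g : Fin k → ℚ) → AtMostOne M →
  0ℚ ≤ℚ B → (∀ i → g i ≤ℚ B) → sumℚ (select M g) ≤ℚ B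
sumℚ-select-≤ {ℕ.zero}  _ _ 0≤B _ = 0≤B
sumℚ-select-≤ {ℕ.suc _} {M} {B} g unique 0≤B g≤B with M zero in M₀
... | true  = begin
  g zero + sumℚ (select M g ∘ suc)  ≡⟨ cong (g zero +_) (sumℚ-zero rest-unselected) ⟩
  g zero + 0ℚ                       ≡⟨ +-identityʳ (g zero) ⟩
  g zero                            ≤⟨ g≤B zero ⟩
  B                                 ∎
  where
  open ≤-Reasoning
  rest-unselected : ∀ i → select M g (suc i) ≡ 0ℚ
  rest-unselected i with M (suc i) in Mᵢ
  ... | true  = ⊥-elim (0≢1+n (unique M₀ Mᵢ))
  ... | false = refl
... | false = subst (_≤ℚ B) (sym (+-identityˡ _))
  (sumℚ-select-≤ (g ∘ suc) (λ Mᵢ Mⱼ → suc-injective (unique Mᵢ Mⱼ)) 0≤B (g≤B ∘ suc))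

term-≤-sumℚ : ∀ {k} {g : Fin k → ℚ} → (∀ i → 0ℚ ≤ℚ g i) → ∀ i → g i ≤ℚ sumℚ g
term-≤-sumℚ {g = g} g≥0 i =
  subst (_≤ℚ sumℚ g) (sumℚ-select-singleton i g) (sumℚ-mono-≤ selected-≤)
  where
  selected-≤ : ∀ j → select (singleton i) g j ≤ℚ g j
  selected-≤ j with singleton i j
  ... | true  = ≤-refl
  ... | false = g≥0 j

sumℚ-≤-*-sumℚ-recipℕ : ∀ {k} {z : Fin k → ℚ} {f : Fin k → ℕ} {V} → (∀ i → 1 ≤ f i) →
  (∀ i → z i * ℕ→ℚ (f i) ≤ℚ V) → sumℚ z ≤ℚ V * sumℚ (λ i → recipℕ (f i))
sumℚ-≤-*-sumℚ-recipℕ {z = z} {f} {V} f≥1 zf≤V =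
  subst (sumℚ z ≤ℚ_) (sym (*-distribˡ-sumℚ V (λ i → recipℕ (f i)))) (sumℚ-mono-≤ z≤V/f)
  where
  z≤V/f : ∀ i → z i ≤ℚ V * recipℕ (f i)
  z≤V/f i = begin
    z i                                ≡⟨ sym (*-identityʳ (z i)) ⟩
    z i * 1ℚ                           ≡⟨ cong (z i *_) (sym (ℕ→ℚ-*-recipℕ (f≥1 i))) ⟩
    z i * (ℕ→ℚ (f i) * recipℕ (f i))   ≡⟨ sym (*-assoc (z i) _ _) ⟩
    z i * ℕ→ℚ (f i) * recipℕ (f i)     ≤⟨ *-monoʳ-≤-nonNeg (recipℕ (f i)) {{1/f≥0}} (zf≤V i) ⟩
    V * recipℕ (f i)                   ∎
    where
    open ≤-Reasoning
    1/f≥0 : NonNegative (recipℕ (f i))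
    1/f≥0 = nonNegative (recipℕ-nonNeg (f i))

module Normalisation {k} (g : Fin k → ℚ) (Σg>0 : 0ℚ < sumℚ g) where

  instance
    Σg⁺ : Positive (sumℚ g)
    Σg⁺ = positive Σg>0
    Σg≢0 : NonZero (sumℚ g)
    Σg≢0 = pos⇒nonZero (sumℚ g)

  1/Σg-nonNeg : 0ℚ ≤ℚ 1/ sumℚ g
  1/Σg-nonNeg = <⇒≤ (positive⁻¹ (1/ sumℚ g) {{1/pos⇒pos (sumℚ g)}})

  normalise : Fin k → ℚ
  normalise i = 1/ sumℚ g * g i

  sumℚ-normalise : sumℚ normalise ≡ 1ℚ
  sumℚ-normalise = trans (sym (*-distribˡ-sumℚ (1/ sumℚ g) g)) (*-inverseˡ (sumℚ g))

  normalise-nonNeg : (∀ i → 0ℚ ≤ℚ g i) → ∀ i → 0ℚ ≤ℚ normalise i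
  normalise-nonNeg g≥0 i =
    subst (_≤ℚ normalise i) (*-zeroʳ (1/ sumℚ g))
      (*-monoˡ-≤-nonNeg (1/ sumℚ g) {{nonNegative 1/Σg-nonNeg}} (g≥0 i))

  normalise-*-inverse : ∀ {i x} → g i * x ≡ 1ℚ → normalise i * x ≡ 1/ sumℚ g
  normalise-*-inverse {i} {x} gx≡1 = begin
    1/ sumℚ g * g i * x     ≡⟨ *-assoc (1/ sumℚ g) (g i) x ⟩
    1/ sumℚ g * (g i * x)   ≡⟨ cong (1/ sumℚ g *_) gx≡1 ⟩
    1/ sumℚ g * 1ℚ          ≡⟨ *-identityʳ (1/ sumℚ g) ⟩
    1/ sumℚ g               ∎
    where open ≡-Reasoning

normalise-isWeighting : ∀ G (g : Fin (m G) → ℚ) (Σg>0 : 0ℚ < sumℚ g) → (∀ e → 0ℚ ≤ℚ g e) →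
  IsWeighting G (Normalisation.normalise g Σg>0)
normalise-isWeighting G g Σg>0 g≥0 = (λ e → ẑ≥0 e , ẑ≤1 e) , sumℚ-normalise
  where
  open Normalisation g Σg>0
  ẑ≥0 : ∀ e → 0ℚ ≤ℚ normalise e
  ẑ≥0 = normalise-nonNeg g≥0
  ẑ≤1 : ∀ e → normalise e ≤ℚ 1ℚ
  ẑ≤1 e = subst (normalise e ≤ℚ_) sumℚ-normalise (term-≤-sumℚ ẑ≥0 e)

Adjacent : (G : Graph) → Fin (m G) → Fin (m G) → Set
Adjacent G e e′ = ∃[ v ] (Incident G v e × Incident G v e′)

star-adjacent : ∀ {G} → IsStar G → ∀ e e′ → Adjacent G e e′
star-adjacent (c , c-incident , _) e e′ = c , c-incident e , c-incident e′

singleton-isMatching : ∀ {G} e → IsMatching G (singleton e)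
singleton-isMatching e e₁ e₂ e₁≢e₂ e₁∈ e₂∈ _ = e₁≢e₂ (singleton-atMostOne e e₁∈ e₂∈)

-- matchValue G f z M unfolds to sumℚ (select M (λ e → z e * ℕ→ℚ (f e))).
module _ {G : Graph} (adjacent : ∀ e e′ → Adjacent G e e′) where

  matching-atMostOne : ∀ {M} → IsMatching G M → AtMostOne M
  matching-atMostOne isMatching {e} {e′} e∈M e′∈M =
    decidable-stable (e ≟ e′) (λ e≢e′ → isMatching e e′ e≢e′ e∈M e′∈M (adjacent e e′))

  singleton-isMaximalMatching : ∀ e → IsMaximalMatching G (singleton e)
  singleton-isMaximalMatching e = singleton-isMatching {G} e , maximal
    where
    maximal : ∀ M → IsMatching G M → _⊆ₑ_ {G} (singleton e) M → _⊆ₑ_ {G} M (singleton e)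
    maximal M isMatching e∈M e′ e′∈M =
      dec-true (e′ ≟ e) (matching-atMostOne isMatching e′∈M (e∈M e (dec-true (e ≟ e) refl)))

  maxMatchValue-≥-edge : ∀ {f z V} → IsMaxMatchValue G f z V → ∀ e → z e * ℕ→ℚ (f e) ≤ℚ V
  maxMatchValue-≥-edge {f} {z} {V} (_ , ≤V) e =
    subst (_≤ℚ V) (sumℚ-select-singleton e (λ e → z e * ℕ→ℚ (f e)))
          (≤V (singleton e) (singleton-isMaximalMatching e))

  isMaxMatchValue-uniform : ∀ {f z V} → Fin (m G) → 0ℚ ≤ℚ V →
    (∀ e → z e * ℕ→ℚ (f e) ≡ V) → IsMaxMatchValue G f z V
  isMaxMatchValue-uniform {f} {z} {V} e₀ 0≤V uniform = attained , bounded
    where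
    zf : Fin (m G) → ℚ
    zf e = z e * ℕ→ℚ (f e)
    attained : ∃[ M ] (IsMaximalMatching G M × matchValue G f z M ≡ V)
    attained = singleton e₀ , singleton-isMaximalMatching e₀
             , trans (sumℚ-select-singleton e₀ zf) (uniform e₀)
    bounded : ∀ M → IsMaximalMatching G M → matchValue G f z M ≤ℚ V
    bounded M (isMatching , _) =
      sumℚ-select-≤ zf (matching-atMostOne isMatching) 0≤V (≤-reflexive ∘ uniform)

theorem9 : (G : Graph) (f : Fin (m G) → ℕ) → (∀ e → 1 ≤ f e) → IsStar G →
    IsPolyDensity G f (sumℚ (λ e → recipℕ (f e)))
theorem9 G f f≥1 star@(_ , _ , _ , e₀) = attained , bounded
  where
  adjacent : ∀ e e′ → Adjacent G e e′
  adjacent = star-adjacent {G} star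

  r : Fin (m G) → ℚ
  r e = recipℕ (f e)

  S : ℚ
  S = sumℚ r

  r≥0 : ∀ e → 0ℚ ≤ℚ r e
  r≥0 e = recipℕ-nonNeg (f e)

  S>0 : 0ℚ < S
  S>0 = <-≤-trans (recipℕ-pos (f≥1 e₀)) (term-≤-sumℚ r≥0 e₀)

  open Normalisation r S>0

  balanced : ∀ e → normalise e * ℕ→ℚ (f e) ≡ 1/ S
  balanced e = normalise-*-inverse (trans (*-comm (r e) (ℕ→ℚ (f e))) (ℕ→ℚ-*-recipℕ (f≥1 e)))

  attained : ∃[ z ] ∃[ V ] (IsWeighting G z × IsMaxMatchValue G f z V × V * S ≡ 1ℚ)
  attained = normalise , 1/ S , normalise-isWeighting G r S>0 r≥0
           , isMaxMatchValue-uniform {G} adjacent {f} {normalise} e₀ 1/Σg-nonNeg balanced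
           , *-inverseˡ S

  bounded : ∀ z V → IsWeighting G z → IsMaxMatchValue G f z V → 1ℚ ≤ℚ V * S
  bounded z V (_ , Σz≡1) isMax = subst (_≤ℚ V * S) Σz≡1
    (sumℚ-≤-*-sumℚ-recipℕ f≥1 (maxMatchValue-≥-edge {G} adjacent {f} {z} isMax))
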